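{- Fix $i,j\in\{1,2,3\}$ with $i\ne j$. Let $f$ be a polynomial computed by an IHL formula of depth $\delta$. Then there exist $r\le 4^\delta$ and $3\times3$ matrices $A_1,\ldots,A_r$ whose entries are homogeneous linear forms such that \[ f\cdot E_{i,j} = (\mathrm{id}_3+A_1)(\mathrm{id}_3+A_2)\cdots(\mathrm{id}_3+A_r)-\mathrm{id}_3. \]
   Context: An IHL (input-homogeneous-linear) arithmetic formula is a rooted tree whose leaves are labelled by homogeneous linear forms (no leaf is labelled by a field constant) and whose internal nodes are binary addition or binary multiplication gates; it computes the polynomial at its root. Depth is the length of the longest root-to-leaf path (leaves have depth $0$). $E_{i,j}$ is the $3\times3$ matrix with a $1$ at position $(i,j)$ and zeros elsewhere, and $\mathrm{id}_3$ is the $3\times3$ identity matrix. -}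

module Defs where

import Level
open import Algebra.Bundles using (CommutativeRing)
open import Data.Nat using (ℕ; zero; suc)
  renaming (_⊔_ to _⊔ℕ_)
open import Data.Fin using (Fin; zero; suc)
open import Data.Vec using (Vec; []; _∷_)
open import Data.Product using (∃)
open import Relation.Nullary using (¬_)
open import Relation.Binary.PropositionalEquality using (_≡_)

record IsField {c ℓ} (R : CommutativeRing c ℓ) : Set (c Level.⊔ ℓ) where
  open CommutativeRing R
  field
    1≉0     : ¬ (1# ≈ 0#)
    inverse : ∀ x → ¬ (x ≈ 0#) → ∃ λ y → (x * y) ≈ 1#

-- The polynomial ring K[x₀,…,x_{n-1}] over the commutative ring R,
-- presented as the free commutative R-algebra on n generators:
-- syntactic terms modulo the congruence generated by the commutative
-- ring axioms and the requirement that constants form a ring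
-- homomorphic image of R.
module PolyRing {c ℓ} (R : CommutativeRing c ℓ) (n : ℕ) where
  private
    module R = CommutativeRing R
  K = R.Carrier

  infixl 6 _⊕_
  infixl 7 _⊗_
  infix 4 _≈ₚ_

  data Poly : Set c where
    con : K → Poly
    var : Fin n → Poly
    _⊕_ : Poly → Poly → Poly
    _⊗_ : Poly → Poly → Poly
    ⊝_  : Poly → Poly

  data _≈ₚ_ : Poly → Poly → Set (c Level.⊔ ℓ) where
    refl  : ∀ {p} → p ≈ₚ p
    sym   : ∀ {p q} → p ≈ₚ q → q ≈ₚ p
    trans : ∀ {p q r} → p ≈ₚ q → q ≈ₚ r → p ≈ₚ r
    ⊕-cong : ∀ {p p' q q'} → p ≈ₚ p' → q ≈ₚ q' → p ⊕ q ≈ₚ p' ⊕ q'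
    ⊗-cong : ∀ {p p' q q'} → p ≈ₚ p' → q ≈ₚ q' → p ⊗ q ≈ₚ p' ⊗ q'
    ⊝-cong : ∀ {p q} → p ≈ₚ q → ⊝ p ≈ₚ ⊝ q
    ⊕-assoc : ∀ p q r → (p ⊕ q) ⊕ r ≈ₚ p ⊕ (q ⊕ r)
    ⊕-comm  : ∀ p q → p ⊕ q ≈ₚ q ⊕ p
    ⊕-idˡ   : ∀ p → con R.0# ⊕ p ≈ₚ p
    ⊝-invˡ  : ∀ p → (⊝ p) ⊕ p ≈ₚ con R.0#
    ⊗-assoc : ∀ p q r → (p ⊗ q) ⊗ r ≈ₚ p ⊗ (q ⊗ r)
    ⊗-comm  : ∀ p q → p ⊗ q ≈ₚ q ⊗ p
    ⊗-idˡ   : ∀ p → con R.1# ⊗ p ≈ₚ p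
    distribˡ : ∀ p q r → p ⊗ (q ⊕ r) ≈ₚ (p ⊗ q) ⊕ (p ⊗ r)
    con-cong : ∀ {a b} → a R.≈ b → con a ≈ₚ con b
    con-+    : ∀ a b → con (a R.+ b) ≈ₚ con a ⊕ con b
    con-*    : ∀ a b → con (a R.* b) ≈ₚ con a ⊗ con b

  LinForm : Set c
  LinForm = Vec K n

  ⟦_⟧ₗ : ∀ {m} → Vec K m → (Fin m → Fin n) → Poly
  ⟦ [] ⟧ₗ     ι = con R.0#
  ⟦ a ∷ as ⟧ₗ ι = (con a ⊗ var (ι zero)) ⊕ ⟦ as ⟧ₗ (λ k → ι (suc k))

  linPoly : LinForm → Poly
  linPoly ℓf = ⟦ ℓf ⟧ₗ (λ k → k)

  data IHL : Set c where
    leaf : LinForm → IHL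
    add  : IHL → IHL → IHL
    mul  : IHL → IHL → IHL

  depth : IHL → ℕ
  depth (leaf _)  = 0
  depth (add φ ψ) = suc (depth φ ⊔ℕ depth ψ)
  depth (mul φ ψ) = suc (depth φ ⊔ℕ depth ψ)

  eval : IHL → Poly
  eval (leaf ℓf) = linPoly ℓf
  eval (add φ ψ) = eval φ ⊕ eval ψ
  eval (mul φ ψ) = eval φ ⊗ eval ψ

  Mat : Set c
  Mat = Fin 3 → Fin 3 → Poly

  _≈ₘ_ : Mat → Mat → Set (c Level.⊔ ℓ)
  M ≈ₘ N = ∀ a b → M a b ≈ₚ N a b

  sum3 : (Fin 3 → Poly) → Poly
  sum3 g = (g zero ⊕ g (suc zero)) ⊕ g (suc (suc zero))

  _·ₘ_ : Mat → Mat → Mat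
  (M ·ₘ N) a b = sum3 (λ k → M a k ⊗ N k b)

  _+ₘ_ : Mat → Mat → Mat
  (M +ₘ N) a b = M a b ⊕ N a b

  _-ₘ_ : Mat → Mat → Mat
  (M -ₘ N) a b = M a b ⊕ (⊝ N a b)

  δ : ∀ {m} → Fin m → Fin m → Poly
  δ zero zero = con R.1#
  δ (suc a) (suc b) = δ a b
  δ _ _ = con R.0#

  id₃ : Mat
  id₃ = δ

  E : Fin 3 → Fin 3 → Mat
  E i j a b = δ i a ⊗ δ j b

  _·ₛ_ : Poly → Mat → Mat
  (p ·ₛ M) a b = p ⊗ M a b

  LinMat : Set c
  LinMat = Fin 3 → Fin 3 → LinForm

  toMat : LinMat → Mat
  toMat A a b = linPoly (A a b)

  prodId+ : ∀ {r} → Vec LinMat r → Mat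
  prodId+ []       = id₃
  prodId+ (A ∷ As) = (id₃ +ₘ toMat A) ·ₘ prodId+ As

{-# OPTIONS --safe #-}

-- Write X_pq(u) = id₃ + u·E_pq (p ≢ q) for the transvections.  They satisfy
-- X_ij(u) X_ij(v) = X_ij(u + v) and, for i, k, j distinct, the commutator
-- relation X_ik(u) X_kj(v) X_ik(−u) X_kj(−v) = X_ij(uv).  By induction on the
-- formula, X_ij(c·f) is a product of at most 4^depth factors id₃ + A with A
-- linear, for every scalar c: a leaf is a single such factor, a sum costs two
-- factorisations and a product four.  The scalar c is what lets the commutator
-- use X(−u) while keeping leaves linear.  Finally X_ij(f) − id₃ = f·E_ij.

module Submission where

open import Defs
open import Algebra.Bundles using (CommutativeRing)
open import Data.Nat using (ℕ; _≤_; _^_)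
open import Data.Fin using (Fin)
open import Data.Vec using (Vec)
open import Data.Product using (Σ; _×_)
open import Relation.Binary.PropositionalEquality using (_≢_)

import Level
open import Algebra.Definitions using (Congruent₁)
open import Algebra.Structures using (IsCommutativeRing)
import Algebra.Properties.Group as GroupProperties
open import Data.Empty using (⊥-elim)
open import Data.Fin using (zero; suc)
open import Data.Nat using (z≤n; s≤s; _⊔_; _+_)
open import Data.Nat.Properties using (≤-trans; ^-monoʳ-≤; m≤m⊔n; m≤n⊔m; +-mono-≤; m≤m+n)
open import Data.Product using (_,_)
open import Data.Vec using ([]; _∷_; _++_; map)
open import Function using (_∘_)
open import Relation.Binary.Bundles using (Setoid)
import Relation.Binary.PropositionalEquality as ≡

module Transvections {c ℓ} (F : CommutativeRing c ℓ) (n : ℕ) where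
  open PolyRing F n
  private module F = CommutativeRing F

  ⊕-identityʳ : ∀ p → p ⊕ con F.0# ≈ₚ p
  ⊕-identityʳ p = trans (⊕-comm _ _) (⊕-idˡ p)

  isCommutativeRing : IsCommutativeRing _≈ₚ_ _⊕_ _⊗_ ⊝_ (con F.0#) (con F.1#)
  isCommutativeRing = record
    { isRing = record
      { +-isAbelianGroup = record
        { isGroup = record
          { isMonoid = record
            { isSemigroup = record
              { isMagma = record
                { isEquivalence = record { refl = refl ; sym = sym ; trans = trans }
                ; ∙-cong = ⊕-cong }
              ; assoc = ⊕-assoc }
            ; identity = ⊕-idˡ , ⊕-identityʳ }
          ; inverse = ⊝-invˡ , (λ p → trans (⊕-comm _ _) (⊝-invˡ p))
          ; ⁻¹-cong = ⊝-cong }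
        ; comm = ⊕-comm }
      ; *-cong = ⊗-cong
      ; *-assoc = ⊗-assoc
      ; *-identity = ⊗-idˡ , (λ p → trans (⊗-comm _ _) (⊗-idˡ p))
      ; distrib = distribˡ , λ p q r →
          trans (⊗-comm _ _) (trans (distribˡ p q r) (⊕-cong (⊗-comm _ _) (⊗-comm _ _))) }
    ; *-comm = ⊗-comm }

  polyRing : CommutativeRing c (c Level.⊔ ℓ)
  polyRing = record { isCommutativeRing = isCommutativeRing }

  open CommutativeRing polyRing using (zeroˡ; zeroʳ; +-group; ring; commutativeSemiring)
  open import Algebra.Properties.Ring ring using (-‿distribˡ-*)
  open import Algebra.Solver.Ring.NaturalCoefficients.Default commutativeSemiring
    using (solve; _:+_; _:*_; _:=_)

  con-neg : ∀ a → con (F.- a) ≈ₚ ⊝ con a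
  con-neg a = GroupProperties.inverseˡ-unique +-group (con (F.- a)) (con a)
    (trans (sym (con-+ (F.- a) a)) (con-cong (F.-‿inverseˡ a)))

  ⟦⟧ₗ-map-* : ∀ {m} k (v : Vec K m) ι → ⟦ map (k F.*_) v ⟧ₗ ι ≈ₚ con k ⊗ ⟦ v ⟧ₗ ι
  ⟦⟧ₗ-map-* k []      ι = sym (zeroʳ _)
  ⟦⟧ₗ-map-* k (a ∷ v) ι =
    trans (⊕-cong (⊗-cong (con-* k a) refl) (⟦⟧ₗ-map-* k v (ι ∘ suc)))
          (solve 4 (λ k a x s → (k :* a) :* x :+ k :* s := k :* (a :* x :+ s)) refl
            (con k) (con a) (var (ι zero)) (⟦ v ⟧ₗ (ι ∘ suc)))

  δ-diagonal : ∀ {m} (p : Fin m) → δ p p ≈ₚ con F.1#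
  δ-diagonal zero    = refl
  δ-diagonal (suc p) = δ-diagonal p

  δ-≢ : ∀ {m} {p a : Fin m} → p ≢ a → δ p a ≈ₚ con F.0#
  δ-≢ {p = zero}  {zero}  p≢a = ⊥-elim (p≢a ≡.refl)
  δ-≢ {p = zero}  {suc a} p≢a = refl
  δ-≢ {p = suc p} {zero}  p≢a = refl
  δ-≢ {p = suc p} {suc a} p≢a = δ-≢ (p≢a ∘ ≡.cong suc)

  sum3-δ : ∀ (a : Fin 3) (Y : Fin 3 → Poly) → sum3 (λ k → δ a k ⊗ Y k) ≈ₚ Y a
  sum3-δ zero Y =
    trans (⊕-cong (⊕-cong (⊗-idˡ _) (zeroˡ _)) (zeroˡ _)) (trans (⊕-identityʳ _) (⊕-identityʳ _))
  sum3-δ (suc zero) Y =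
    trans (⊕-cong (⊕-cong (zeroˡ _) (⊗-idˡ _)) (zeroˡ _)) (trans (⊕-identityʳ _) (⊕-idˡ _))
  sum3-δ (suc (suc zero)) Y =
    trans (⊕-cong (⊕-cong (zeroˡ _) (zeroˡ _)) (⊗-idˡ _)) (trans (⊕-cong (⊕-idˡ _) refl) (⊕-idˡ _))

  δᴷ : ∀ {m} → Fin m → Fin m → K
  δᴷ zero    zero    = F.1#
  δᴷ (suc a) (suc b) = δᴷ a b
  δᴷ _       _       = F.0#

  con-δᴷ : ∀ {m} (p q : Fin m) → con (δᴷ p q) ≈ₚ δ p q
  con-δᴷ zero    zero    = refl
  con-δᴷ zero    (suc q) = refl
  con-δᴷ (suc p) zero    = refl
  con-δᴷ (suc p) (suc q) = con-δᴷ p q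

  matSetoid : Setoid c (c Level.⊔ ℓ)
  matSetoid = record
    { Carrier = Mat
    ; _≈_ = _≈ₘ_
    ; isEquivalence = record
      { refl  = λ _ _ → refl
      ; sym   = λ e a b → sym (e a b)
      ; trans = λ e e′ a b → trans (e a b) (e′ a b)
      }
    }

  ·ₘ-congˡ : ∀ {M M′} N → M ≈ₘ M′ → (M ·ₘ N) ≈ₘ (M′ ·ₘ N)
  ·ₘ-congˡ N e a b =
    ⊕-cong (⊕-cong (⊗-cong (e a zero) refl) (⊗-cong (e a (suc zero)) refl))
           (⊗-cong (e a (suc (suc zero))) refl)

  ·ₘ-congʳ : ∀ M → Congruent₁ _≈ₘ_ (M ·ₘ_)
  ·ₘ-congʳ M e a b =
    ⊕-cong (⊕-cong (⊗-cong refl (e zero b)) (⊗-cong refl (e (suc zero) b)))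
           (⊗-cong refl (e (suc (suc zero)) b))

  transvection : Fin 3 → Fin 3 → Poly → Mat
  transvection p q u = id₃ +ₘ (u ·ₛ E p q)

  transvection-cong : ∀ p q {u u′} → u ≈ₚ u′ → transvection p q u ≈ₘ transvection p q u′
  transvection-cong p q e a b = ⊕-cong refl (⊗-cong e refl)

  transvection-·ₘ : ∀ p q u N a b →
    (transvection p q u ·ₘ N) a b ≈ₚ N a b ⊕ u ⊗ (δ p a ⊗ N q b)
  transvection-·ₘ p q u N a b =
    trans (solve 11 (λ x₀ x₁ x₂ y₀ y₁ y₂ n₀ n₁ n₂ u s →
              ((x₀ :+ u :* (s :* y₀)) :* n₀ :+ (x₁ :+ u :* (s :* y₁)) :* n₁) :+ (x₂ :+ u :* (s :* y₂)) :* n₂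
              := ((x₀ :* n₀ :+ x₁ :* n₁) :+ x₂ :* n₂) :+ u :* (s :* ((y₀ :* n₀ :+ y₁ :* n₁) :+ y₂ :* n₂)))
            refl
            (δ a zero) (δ a (suc zero)) (δ a (suc (suc zero)))
            (δ q zero) (δ q (suc zero)) (δ q (suc (suc zero)))
            (N zero b) (N (suc zero) b) (N (suc (suc zero)) b) u (δ p a))
          (⊕-cong (sum3-δ a (λ k → N k b)) (⊗-cong refl (⊗-cong refl (sum3-δ q (λ k → N k b)))))

  transvection-·ₘ-row : ∀ p q u N b → (transvection p q u ·ₘ N) p b ≈ₚ N p b ⊕ u ⊗ N q b
  transvection-·ₘ-row p q u N b = trans (transvection-·ₘ p q u N p b)
    (⊕-cong refl (⊗-cong refl (trans (⊗-cong (δ-diagonal p) refl) (⊗-idˡ _))))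

  transvection-·ₘ-otherRow : ∀ p q u N {a} b → p ≢ a → (transvection p q u ·ₘ N) a b ≈ₚ N a b
  transvection-·ₘ-otherRow p q u N {a} b p≢a = trans (transvection-·ₘ p q u N a b)
    (trans (⊕-cong refl (trans (⊗-cong refl (trans (⊗-cong (δ-≢ p≢a) refl) (zeroˡ _))) (zeroʳ _)))
           (⊕-identityʳ _))

  transvection-·ₘ-id₃ : ∀ p q u → ((transvection p q u ·ₘ id₃) -ₘ id₃) ≈ₘ (u ·ₛ E p q)
  transvection-·ₘ-id₃ p q u a b =
    trans (⊕-cong (transvection-·ₘ p q u id₃ a b) refl)
          (trans (solve 3 (λ d w x → (d :+ w) :+ x := w :+ (x :+ d)) refl (δ a b) _ (⊝ δ a b))
                 (trans (⊕-cong refl (⊝-invˡ (δ a b))) (⊕-identityʳ _)))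

  transvection-+ : ∀ {i j} u v N → i ≢ j →
    (transvection i j u ·ₘ (transvection i j v ·ₘ N)) ≈ₘ (transvection i j (u ⊕ v) ·ₘ N)
  transvection-+ {i} {j} u v N i≢j a b =
    trans (transvection-·ₘ i j u (transvection i j v ·ₘ N) a b)
     (trans (⊕-cong (transvection-·ₘ i j v N a b)
                    (⊗-cong refl (⊗-cong refl (transvection-·ₘ-otherRow i j v N b i≢j))))
      (trans (solve 5 (λ x y d u v → (x :+ v :* (d :* y)) :+ u :* (d :* y) := x :+ (u :+ v) :* (d :* y))
                refl (N a b) (N j b) (δ i a) u v)
             (sym (transvection-·ₘ i j (u ⊕ v) N a b))))

  -- The semiring solver knows nothing about ⊝, so it only splits off the
  -- summands that vanish because (⊝ u) ⊕ u ≈ 0 and (⊝ v) ⊕ v ≈ 0.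
  commutator-entry : ∀ x y z d e u v →
    ((((x ⊕ (⊝ v) ⊗ (d ⊗ y)) ⊕ (⊝ u) ⊗ (e ⊗ (z ⊕ (⊝ v) ⊗ y))) ⊕ v ⊗ (d ⊗ y))
      ⊕ u ⊗ (e ⊗ ((z ⊕ (⊝ v) ⊗ y) ⊕ v ⊗ y)))
    ≈ₚ x ⊕ (u ⊗ v) ⊗ (e ⊗ y)
  commutator-entry x y z d e u v =
    trans (solve 9 (λ x y z d e u v u′ v′ →
              (((x :+ v′ :* (d :* y)) :+ u′ :* (e :* (z :+ v′ :* y))) :+ v :* (d :* y))
                :+ u :* (e :* ((z :+ v′ :* y) :+ v :* y))
              := (((x :+ (v′ :+ v) :* (d :* y)) :+ (u′ :+ u) :* (e :* z))
                   :+ (u′ :+ u) :* (e :* (v′ :* y))) :+ (u :* v) :* (e :* y))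
            refl x y z d e u v (⊝ u) (⊝ v))
          (⊕-cong (drop (⊝-invˡ u) (drop (⊝-invˡ u) (drop (⊝-invˡ v) refl))) refl)
    where
      drop : ∀ {s p q w} → s ≈ₚ con F.0# → p ≈ₚ q → p ⊕ s ⊗ w ≈ₚ q
      drop s≈0 p≈q = trans (⊕-cong p≈q (trans (⊗-cong s≈0 refl) (zeroˡ _))) (⊕-identityʳ _)

  transvection-commutator : ∀ {i j k} u v N → i ≢ j → i ≢ k → k ≢ j →
    (transvection i k u ·ₘ (transvection k j v ·ₘ
      (transvection i k (⊝ u) ·ₘ (transvection k j (⊝ v) ·ₘ N))))
    ≈ₘ (transvection i j (u ⊗ v) ·ₘ N)
  transvection-commutator {i} {j} {k} u v N i≢j i≢k k≢j a b =
    trans (transvection-·ₘ i k u N₂ a b)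
     (trans (⊕-cong N₂a (⊗-cong refl (⊗-cong refl N₂k)))
      (trans (commutator-entry (N a b) (N j b) (N k b) (δ k a) (δ i a) u v)
             (sym (transvection-·ₘ i j (u ⊗ v) N a b))))
    where
      N₄ N₃ N₂ : Mat
      N₄ = transvection k j (⊝ v) ·ₘ N
      N₃ = transvection i k (⊝ u) ·ₘ N₄
      N₂ = transvection k j v ·ₘ N₃
      N₄k : N₄ k b ≈ₚ N k b ⊕ (⊝ v) ⊗ N j b
      N₄k = transvection-·ₘ-row k j (⊝ v) N b
      N₃j : N₃ j b ≈ₚ N j b
      N₃j = trans (transvection-·ₘ-otherRow i k (⊝ u) N₄ b i≢j)
                  (transvection-·ₘ-otherRow k j (⊝ v) N b k≢j)
      N₃a : N₃ a b ≈ₚ (N a b ⊕ (⊝ v) ⊗ (δ k a ⊗ N j b)) ⊕ (⊝ u) ⊗ (δ i a ⊗ (N k b ⊕ (⊝ v) ⊗ N j b))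
      N₃a = trans (transvection-·ₘ i k (⊝ u) N₄ a b)
                  (⊕-cong (transvection-·ₘ k j (⊝ v) N a b) (⊗-cong refl (⊗-cong refl N₄k)))
      N₂a : N₂ a b ≈ₚ ((N a b ⊕ (⊝ v) ⊗ (δ k a ⊗ N j b)) ⊕ (⊝ u) ⊗ (δ i a ⊗ (N k b ⊕ (⊝ v) ⊗ N j b)))
                      ⊕ v ⊗ (δ k a ⊗ N j b)
      N₂a = trans (transvection-·ₘ k j v N₃ a b) (⊕-cong N₃a (⊗-cong refl (⊗-cong refl N₃j)))
      N₂k : N₂ k b ≈ₚ (N k b ⊕ (⊝ v) ⊗ N j b) ⊕ v ⊗ N j b
      N₂k = trans (transvection-·ₘ-row k j v N₃ b)
                  (⊕-cong (trans (transvection-·ₘ-otherRow i k (⊝ u) N₄ b i≢k) N₄k)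
                          (⊗-cong refl N₃j))

  prodId+-++-assoc : ∀ {r s t} (As : Vec LinMat r) (Bs : Vec LinMat s) (Cs : Vec LinMat t) →
    prodId+ ((As ++ Bs) ++ Cs) ≈ₘ prodId+ (As ++ (Bs ++ Cs))
  prodId+-++-assoc []       Bs Cs a b = refl
  prodId+-++-assoc (A ∷ As) Bs Cs = ·ₘ-congʳ (id₃ +ₘ toMat A) (prodId+-++-assoc As Bs Cs)

  prodId+-++-[] : ∀ {r} (As : Vec LinMat r) → prodId+ (As ++ []) ≈ₘ prodId+ As
  prodId+-++-[] []       a b = refl
  prodId+-++-[] (A ∷ As) = ·ₘ-congʳ (id₃ +ₘ toMat A) (prodId+-++-[] As)

  -- Matrix products are only associative up to ≈ₘ, so a word of factors is
  -- related to the action it induces by left multiplication rather than to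
  -- a single matrix.
  record Factorisation (bound : ℕ) (f : Mat → Mat) : Set (c Level.⊔ ℓ) where
    constructor factorisation⟨_,_,_⟩
    field
      {length}   : ℕ
      length≤    : length ≤ bound
      factors    : Vec LinMat length
      represents : ∀ {m} (Bs : Vec LinMat m) → prodId+ (factors ++ Bs) ≈ₘ f (prodId+ Bs)

  factorisation-++ : ∀ {b b′ f g} → Congruent₁ _≈ₘ_ f →
    Factorisation b f → Factorisation b′ g → Factorisation (b + b′) (f ∘ g)
  factorisation-++ {f = f} {g} f-cong factorisation⟨ r≤b , As , As≈f ⟩ factorisation⟨ r′≤b′ , Bs , Bs≈g ⟩ =
    factorisation⟨ +-mono-≤ r≤b r′≤b′ , As ++ Bs , (λ Cs → begin
      prodId+ ((As ++ Bs) ++ Cs)  ≈⟨ prodId+-++-assoc As Bs Cs ⟩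
      prodId+ (As ++ (Bs ++ Cs))  ≈⟨ As≈f (Bs ++ Cs) ⟩
      f (prodId+ (Bs ++ Cs))      ≈⟨ f-cong (Bs≈g Cs) ⟩
      f (g (prodId+ Cs))          ∎) ⟩
    where open import Relation.Binary.Reasoning.Setoid matSetoid

  factorisation-mono : ∀ {b b′ f g} → Factorisation b f → b ≤ b′ → (∀ M → f M ≈ₘ g M) →
    Factorisation b′ g
  factorisation-mono factorisation⟨ r≤b , As , As≈f ⟩ b≤b′ f≈g =
    factorisation⟨ ≤-trans r≤b b≤b′ , As , (λ Bs a b → trans (As≈f Bs a b) (f≈g _ a b)) ⟩

  factorisation-leaf : ∀ i j k lf → Factorisation 1 (transvection i j (con k ⊗ linPoly lf) ·ₘ_)
  factorisation-leaf i j k lf = factorisation⟨ s≤s z≤n , A ∷ [] , (λ Bs →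
    ·ₘ-congˡ (prodId+ Bs) (λ a b → ⊕-cong (refl {δ a b}) (toMat-A a b))) ⟩
    where
      A : LinMat
      A a b = map ((k F.* (δᴷ i a F.* δᴷ j b)) F.*_) lf
      toMat-A : ∀ a b → toMat A a b ≈ₚ (con k ⊗ linPoly lf) ⊗ (δ i a ⊗ δ j b)
      toMat-A a b =
        trans (⟦⟧ₗ-map-* _ lf (λ z → z))
         (trans (⊗-cong (trans (con-* k _) (⊗-cong refl (trans (con-* _ _)
                  (⊗-cong (con-δᴷ i a) (con-δᴷ j b))))) refl)
                (solve 3 (λ k d l → (k :* d) :* l := (k :* l) :* d) refl (con k) _ _))

  thirdIndex : ∀ {i j : Fin 3} → i ≢ j → Σ (Fin 3) λ k → i ≢ k × k ≢ j
  thirdIndex {zero}           {zero}           i≢j = ⊥-elim (i≢j ≡.refl)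
  thirdIndex {zero}           {suc zero}       _   = suc (suc zero) , (λ ()) , (λ ())
  thirdIndex {zero}           {suc (suc zero)} _   = suc zero , (λ ()) , (λ ())
  thirdIndex {suc zero}       {zero}           _   = suc (suc zero) , (λ ()) , (λ ())
  thirdIndex {suc zero}       {suc zero}       i≢j = ⊥-elim (i≢j ≡.refl)
  thirdIndex {suc zero}       {suc (suc zero)} _   = zero , (λ ()) , (λ ())
  thirdIndex {suc (suc zero)} {zero}           _   = suc zero , (λ ()) , (λ ())
  thirdIndex {suc (suc zero)} {suc zero}       _   = zero , (λ ()) , (λ ())
  thirdIndex {suc (suc zero)} {suc (suc zero)} i≢j = ⊥-elim (i≢j ≡.refl)

  4^-⊔ˡ : ∀ a b → 4 ^ a ≤ 4 ^ (a ⊔ b)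
  4^-⊔ˡ a b = ^-monoʳ-≤ 4 (m≤m⊔n a b)

  4^-⊔ʳ : ∀ a b → 4 ^ b ≤ 4 ^ (a ⊔ b)
  4^-⊔ʳ a b = ^-monoʳ-≤ 4 (m≤n⊔m a b)

  factorisation : ∀ φ {i j} → i ≢ j → ∀ k →
    Factorisation (4 ^ depth φ) (transvection i j (con k ⊗ eval φ) ·ₘ_)
  factorisation (leaf lf) {i} {j} _ k = factorisation-leaf i j k lf
  factorisation (add φ ψ) {i} {j} i≢j k =
    factorisation-mono
      (factorisation-++ (·ₘ-congʳ (transvection i j (con k ⊗ eval φ)))
        (factorisation φ i≢j k) (factorisation ψ i≢j k))
      (+-mono-≤ (4^-⊔ˡ (depth φ) (depth ψ)) (≤-trans (4^-⊔ʳ (depth φ) (depth ψ)) (m≤m+n _ _)))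
      (λ N → trans-ₘ (transvection-+ _ _ N i≢j)
                     (·ₘ-congˡ N (transvection-cong i j (sym (distribˡ _ _ _)))))
    where open Setoid matSetoid using () renaming (trans to trans-ₘ)
  factorisation (mul φ ψ) {i} {j} i≢j k with thirdIndex i≢j
  ... | l , i≢l , l≢j =
    factorisation-mono
      (factorisation-++ (·ₘ-congʳ (transvection i l u)) (factorisation φ i≢l k)
        (factorisation-++ (·ₘ-congʳ (transvection l j v)) (factorisation ψ l≢j F.1#)
          (factorisation-++ (·ₘ-congʳ (transvection i l u⁻)) (factorisation φ i≢l (F.- k))
            (factorisation ψ l≢j (F.- F.1#)))))
      (+-mono-≤ (4^-⊔ˡ dφ dψ) (+-mono-≤ (4^-⊔ʳ dφ dψ)
        (+-mono-≤ (4^-⊔ˡ dφ dψ) (≤-trans (4^-⊔ʳ dφ dψ) (m≤m+n _ 0)))))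
      commutator
    where
      dφ dψ : ℕ
      dφ = depth φ
      dψ = depth ψ
      u v u⁻ v⁻ : Poly
      u = con k ⊗ eval φ
      v = con F.1# ⊗ eval ψ
      u⁻ = con (F.- k) ⊗ eval φ
      v⁻ = con (F.- F.1#) ⊗ eval ψ
      con-neg-⊗ : ∀ a f → con (F.- a) ⊗ f ≈ₚ ⊝ (con a ⊗ f)
      con-neg-⊗ a f = trans (⊗-cong (con-neg a) refl) (sym (-‿distribˡ-* (con a) f))
      commutator : ∀ N →
        (transvection i l u ·ₘ (transvection l j v ·ₘ (transvection i l u⁻ ·ₘ (transvection l j v⁻ ·ₘ N))))
        ≈ₘ (transvection i j (con k ⊗ (eval φ ⊗ eval ψ)) ·ₘ N)
      commutator N = begin
        X₁ ·ₘ (X₂ ·ₘ (transvection i l u⁻ ·ₘ (transvection l j v⁻ ·ₘ N)))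
          ≈⟨ ·ₘ-congʳ X₁ (·ₘ-congʳ X₂ (·ₘ-congˡ (transvection l j v⁻ ·ₘ N)
               (transvection-cong i l (con-neg-⊗ k (eval φ))))) ⟩
        X₁ ·ₘ (X₂ ·ₘ (transvection i l (⊝ u) ·ₘ (transvection l j v⁻ ·ₘ N)))
          ≈⟨ ·ₘ-congʳ X₁ (·ₘ-congʳ X₂ (·ₘ-congʳ (transvection i l (⊝ u)) (·ₘ-congˡ N
               (transvection-cong l j (con-neg-⊗ F.1# (eval ψ)))))) ⟩
        X₁ ·ₘ (X₂ ·ₘ (transvection i l (⊝ u) ·ₘ (transvection l j (⊝ v) ·ₘ N)))
          ≈⟨ transvection-commutator u v N i≢j i≢l l≢j ⟩
        transvection i j (u ⊗ v) ·ₘ N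
          ≈⟨ ·ₘ-congˡ N (transvection-cong i j (trans (⊗-cong refl (⊗-idˡ _)) (⊗-assoc _ _ _))) ⟩
        transvection i j (con k ⊗ (eval φ ⊗ eval ψ)) ·ₘ N ∎
        where
          open import Relation.Binary.Reasoning.Setoid matSetoid
          X₁ X₂ : Mat
          X₁ = transvection i l u
          X₂ = transvection l j v

  elementaryFactorisation : ∀ {i j} → i ≢ j → (φ : IHL) →
    Σ ℕ λ r → r ≤ 4 ^ depth φ × Σ (Vec LinMat r) λ As →
      (eval φ ·ₛ E i j) ≈ₘ (prodId+ As -ₘ id₃)
  elementaryFactorisation {i} {j} i≢j φ with factorisation φ i≢j F.1#
  ... | factorisation⟨ r≤4^d , As , As≈X ⟩ = _ , r≤4^d , As , λ a b → sym (begin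
    prodId+ As a b ⊕ ⊝ id₃ a b
      ≈⟨ ⊕-cong (trans (sym (prodId+-++-[] As a b)) (As≈X [] a b)) refl ⟩
    (transvection i j (con F.1# ⊗ eval φ) ·ₘ id₃) a b ⊕ ⊝ id₃ a b
      ≈⟨ transvection-·ₘ-id₃ i j _ a b ⟩
    (con F.1# ⊗ eval φ) ⊗ E i j a b
      ≈⟨ ⊗-cong (⊗-idˡ _) refl ⟩
    eval φ ⊗ E i j a b ∎)
    where open import Relation.Binary.Reasoning.Setoid (CommutativeRing.setoid polyRing)

mainTheorem16 : ∀ {c ℓ} (F : CommutativeRing c ℓ) → IsField F → (n : ℕ)
    → (i j : Fin 3) → i ≢ j
    → (φ : PolyRing.IHL F n)
    → Σ ℕ λ r → r ≤ 4 ^ PolyRing.depth F n φ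
      × Σ (Vec (PolyRing.LinMat F n) r) λ As →
        PolyRing._≈ₘ_ F n
          (PolyRing._·ₛ_ F n (PolyRing.eval F n φ) (PolyRing.E F n i j))
          (PolyRing._-ₘ_ F n (PolyRing.prodId+ F n As) (PolyRing.id₃ F n))
mainTheorem16 F _ n i j i≢j = Transvections.elementaryFactorisation F n i≢j
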